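{- The map $\Phi$ induces a bijection from $\mathrm{MotzPF}_n/\!\sim$ to the set $\mathrm{Motz}_n$ of Motzkin paths of length $n$.
   Context: $[n]=\{1,\dots,n\}$. A parking function of length $n$ is $p\in[n]^n$ whose non-decreasing rearrangement $a_1\le\dots\le a_n$ satisfies $a_i\le i$ for all $i$. $\mathrm{MotzPF}_n$ is the set of parking functions $p$ of length $n$ such that $|\{i:p_i=j\}|\le 2$ for every $j\in[n]$. For $p,p'\in\mathrm{MotzPF}_n$, $p\sim p'$ if $p'$ is obtained by permuting the entries of $p$. For $p\in[n]^n$, $\Phi(p)=\phi_1\cdots\phi_n$ is the lattice path with steps $\phi_j=U=(1,1)$ if $|\{i:p_i=j\}|\ge2$, $\phi_j=H=(1,0)$ if $|\{i:p_i=j\}|=1$, $\phi_j=D=(1,-1)$ if $|\{i:p_i=j\}|=0$; it is constant on $\sim$-classes. $\mathrm{Motz}_n$ is the set of lattice paths from $(0,0)$ to $(n,0)$ with steps $U,H,D$ never going below the $x$-axis. -}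

module Defs where

open import Data.Nat using (ℕ; zero; suc; _≤_)
open import Data.Fin using (Fin; toℕ)
open import Data.Fin.Permutation using (Permutation′; _⟨$⟩ʳ_)
open import Data.List using (List; []; _∷_; length; filter)
open import Data.Vec using (Vec; tabulate; toList)
open import Data.Fin.Base using () renaming (_≤_ to _≤ᶠ_)
open import Data.Fin.Properties using (_≟_)
open import Data.List using (allFin)
open import Data.Integer using (ℤ; +_; _+_; -[1+_]; 0ℤ; +0) renaming (_≤_ to _≤ℤ_)
open import Data.Product using (Σ; _×_)
open import Relation.Binary.PropositionalEquality using (_≡_)

-- Convention: [n] = {1,…,n} is represented by Fin n, value j ∈ Fin n
-- standing for j+1.  A word p ∈ [n]^n is a function Fin n → Fin n.

Word : ℕ → Set
Word n = Fin n → Fin n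

permute : ∀ {n} → Permutation′ n → Word n → Word n
permute σ p i = p (σ ⟨$⟩ʳ i)

NonDecreasing : ∀ {n} → Word n → Set
NonDecreasing {n} a = (i j : Fin n) → toℕ i ≤ toℕ j → toℕ (a i) ≤ toℕ (a j)

-- p is a parking function: its non-decreasing rearrangement a satisfies
-- a_i ≤ i for all i (1-indexed; equivalently toℕ (a i) ≤ toℕ i 0-indexed).
IsParkingFunction : ∀ {n} → Word n → Set
IsParkingFunction {n} p =
  Σ (Permutation′ n) λ σ →
    NonDecreasing (permute σ p) × ((i : Fin n) → toℕ (permute σ p i) ≤ toℕ i)

count : ∀ {n} → Word n → Fin n → ℕ
count {n} p j = length (filter (λ i → p i ≟ j) (allFin n))

IsMotzPF : ∀ {n} → Word n → Set
IsMotzPF {n} p = IsParkingFunction p × ((j : Fin n) → count p j ≤ 2)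

_∼_ : ∀ {n} → Word n → Word n → Set
_∼_ {n} p p' = Σ (Permutation′ n) λ σ → (i : Fin n) → p' i ≡ permute σ p i

data Step : Set where
  U H D : Step

stepOf : ℕ → Step
stepOf zero = D
stepOf (suc zero) = H
stepOf (suc (suc _)) = U

Φ : ∀ {n} → Word n → Vec Step n
Φ p = tabulate (λ j → stepOf (count p j))

Δ : Step → ℤ
Δ U = + 1
Δ H = 0ℤ
Δ D = -[1+ 0 ]

NonNegFrom : ℤ → List Step → Set
NonNegFrom h [] = h ≡ 0ℤ
NonNegFrom h (s ∷ ss) = (0ℤ ≤ℤ (h + Δ s)) × NonNegFrom (h + Δ s) ss

IsMotzkin : ∀ {n} → Vec Step n → Set
IsMotzkin w = NonNegFrom 0ℤ (toList w)

-- Only the multiset of values of a word matters for Φ, and Φ p records the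
-- multiplicities count p j, which for a Motzkin parking function lie in
-- {0, 1, 2} and can therefore be read back from Φ p.  A sequence g of
-- multiplicities is the content of a parking function exactly when its
-- partial sums satisfy g 0 + … + g (k-1) ≥ k with total n; in the path of
-- steps stepOf (g j) the quantity g 0 + … + g (k-1) − k is the height after
-- k steps, so this is exactly the Motzkin condition.  Conversely the word
-- listing each j exactly g j times in increasing order is a parking function
-- with content g.
module Submission where

open import Defs
import Algebra.Properties.CommutativeMonoid.Sum as Sum
open import Data.Bool using (true; false; if_then_else_)
open import Data.Empty using (⊥-elim)
open import Data.Fin using (Fin; zero; suc; toℕ; fromℕ<; cast)
open import Data.Fin.Permutation as Perm using (Permutation′; _⟨$⟩ʳ_; _∘ₚ_; cast-id)
open import Data.Fin.Properties using (_≟_; toℕ<n; toℕ-fromℕ<; cast-involutive)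
open import Data.Integer using (+_; -[1+_]; 0ℤ; +≤+) renaming (_+_ to _+ℤ_; _≤_ to _≤ℤ_)
open import Data.List using (List; []; _∷_; _++_; length; filter; lookup)
import Data.List as List
import Data.List.Properties as List
open import Data.List.Membership.Propositional using (_∈_)
open import Data.List.Membership.Propositional.Properties using (∈-∃++)
open import Data.List.Relation.Binary.Permutation.Propositional using (_↭_; prep; ↭-trans; ↭-sym; ↭⇒↭ₛ)
open import Data.List.Relation.Binary.Permutation.Propositional.Properties using (shift; filter-↭; ↭-length)
import Data.List.Relation.Binary.Permutation.Setoid as ↭ₛ
import Data.List.Relation.Binary.Permutation.Setoid.Properties as ↭ₛProperties
open import Data.List.Relation.Unary.Any using (here; there)
open import Data.Nat using (ℕ; zero; suc; _+_; _∸_; _≤_; _<_; z≤n; s≤s; s≤s⁻¹; _<?_)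
open import Data.Nat.Properties hiding (_≟_)
open import Data.Product using (Σ; _×_; _,_; proj₂)
open import Data.Vec using (Vec; []; _∷_; toList)
import Data.Vec as Vec
import Data.Vec.Properties as Vec
open import Function using (_∘_; _⇔_; mk⇔; Equivalence)
open import Relation.Binary.Definitions using (DecidableEquality)
open import Relation.Nullary using (Dec; yes; no; does; ¬_)
open import Relation.Binary.PropositionalEquality

open Sum +-0-commutativeMonoid using (sum; sum-syntax; ∑-distrib-+; sum-permute; sum-cong-≗; sum-replicate-zero)
open Equivalence using (to; from)

-- Defined through does, so that indicators of _<?_ and of Fin's _≟_ at
-- successors reduce definitionally to those at the predecessors.
indicator : ∀ {p} {P : Set p} → Dec P → ℕ
indicator d = if does d then 1 else 0

indicator-cong : ∀ {p q} {P : Set p} {Q : Set q} (d : Dec P) (e : Dec Q) →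
                 (P → Q) → (Q → P) → indicator d ≡ indicator e
indicator-cong (yes _) (yes _) _ _ = refl
indicator-cong (yes p) (no ¬q) p⇒q _ = ⊥-elim (¬q (p⇒q p))
indicator-cong (no ¬p) (yes q) _ q⇒p = ⊥-elim (¬p (q⇒p q))
indicator-cong (no _) (no _) _ _ = refl

indicator-mono : ∀ {p q} {P : Set p} {Q : Set q} (d : Dec P) (e : Dec Q) →
                 (P → Q) → indicator d ≤ indicator e
indicator-mono (yes _) (yes _) _ = ≤-refl
indicator-mono (yes p) (no ¬q) p⇒q = ⊥-elim (¬q (p⇒q p))
indicator-mono (no _) _ _ = z≤n

sum-mono-≤ : ∀ {m} {f g : Fin m → ℕ} → (∀ i → f i ≤ g i) → sum f ≤ sum g
sum-mono-≤ {zero} f≤g = z≤n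
sum-mono-≤ {suc m} f≤g = +-mono-≤ (f≤g zero) (sum-mono-≤ (f≤g ∘ suc))

∑-indicator-< : ∀ {m} k → k ≤ m → ∑[ i < m ] indicator (toℕ i <? k) ≡ k
∑-indicator-< {m} zero _ = sum-replicate-zero m
∑-indicator-< {suc m} (suc k) (s≤s k≤m) = cong suc (∑-indicator-< k k≤m)

length-filter-tabulate : ∀ {a p} {A : Set a} {P : A → Set p} (P? : ∀ x → Dec (P x)) {m} (f : Fin m → A) →
                         length (filter P? (List.tabulate f)) ≡ ∑[ i < m ] indicator (P? (f i))
length-filter-tabulate P? {zero} f = refl
length-filter-tabulate P? {suc m} f with does (P? (f zero))
... | true = cong suc (length-filter-tabulate P? (f ∘ suc))
... | false = length-filter-tabulate P? (f ∘ suc)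

prefixSum : ∀ {m} → (Fin m → ℕ) → ℕ → ℕ
prefixSum g zero = 0
prefixSum {zero} g (suc k) = 0
prefixSum {suc m} g (suc k) = g zero + prefixSum (g ∘ suc) k

prefixSum-cong : ∀ {m} {f g : Fin m → ℕ} → (∀ j → f j ≡ g j) → ∀ k → prefixSum f k ≡ prefixSum g k
prefixSum-cong f≗g zero = refl
prefixSum-cong {zero} f≗g (suc k) = refl
prefixSum-cong {suc m} f≗g (suc k) = cong₂ _+_ (f≗g zero) (prefixSum-cong (f≗g ∘ suc) k)

prefixSum-zero : ∀ {m} k → prefixSum {m} (λ _ → 0) k ≡ 0
prefixSum-zero zero = refl
prefixSum-zero {zero} (suc k) = refl
prefixSum-zero {suc m} (suc k) = prefixSum-zero {m} k

prefixSum-distrib-∑ : ∀ {m n} (F : Fin n → Fin m → ℕ) k →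
                      prefixSum (λ j → ∑[ i < n ] F i j) k ≡ ∑[ i < n ] prefixSum (F i) k
prefixSum-distrib-∑ {n = n} F zero = sym (sum-replicate-zero n)
prefixSum-distrib-∑ {zero} {n} F (suc k) = sym (sum-replicate-zero n)
prefixSum-distrib-∑ {suc m} F (suc k) = trans
  (cong (_+_ (∑[ i < _ ] F i zero)) (prefixSum-distrib-∑ (λ i → F i ∘ suc) k))
  (sym (∑-distrib-+ (λ i → F i zero) (λ i → prefixSum (F i ∘ suc) k)))

prefixSum-indicator : ∀ {m} (x : Fin m) k → prefixSum (λ j → indicator (x ≟ j)) k ≡ indicator (toℕ x <? k)
prefixSum-indicator x zero = refl
prefixSum-indicator zero (suc k) = cong suc (prefixSum-zero k)
prefixSum-indicator (suc x) (suc k) = prefixSum-indicator x k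

prefixSum-mono : ∀ {m} (g : Fin m → ℕ) {k k′} → k ≤ k′ → prefixSum g k ≤ prefixSum g k′
prefixSum-mono g z≤n = z≤n
prefixSum-mono {zero} g (s≤s k≤k′) = z≤n
prefixSum-mono {suc m} g (s≤s k≤k′) = +-monoʳ-≤ (g zero) (prefixSum-mono (g ∘ suc) k≤k′)

prefixSum-injective : ∀ {m} {f g : Fin m → ℕ} →
                      (∀ k → k ≤ m → prefixSum f k ≡ prefixSum g k) → ∀ j → f j ≡ g j
prefixSum-injective {suc m} {f} {g} f≈g zero = begin
  f zero           ≡⟨ +-identityʳ (f zero) ⟨
  prefixSum f 1    ≡⟨ f≈g 1 (s≤s z≤n) ⟩
  prefixSum g 1    ≡⟨ +-identityʳ (g zero) ⟩
  g zero           ∎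
  where open ≡-Reasoning
prefixSum-injective {suc m} {f} {g} f≈g (suc j) =
  prefixSum-injective (λ k k≤m → +-cancelˡ-≡ (f zero) _ _ (begin
    f zero + prefixSum (f ∘ suc) k ≡⟨ f≈g (suc k) (s≤s k≤m) ⟩
    g zero + prefixSum (g ∘ suc) k ≡⟨ cong (_+ _) (prefixSum-injective f≈g zero) ⟨
    f zero + prefixSum (g ∘ suc) k ∎)) j
  where open ≡-Reasoning

-- blockOf g i is the j with prefixSum g j ≤ i < prefixSum g (j + 1) when i
-- lies below the total sum, i.e. the value at position i of the sorted word
-- containing each j exactly g j times.

blockOf : ∀ {m} → (Fin m → ℕ) → ℕ → ℕ
blockOf {zero} g i = 0
blockOf {suc m} g i with i <? g zero
... | yes _ = 0
... | no _ = suc (blockOf (g ∘ suc) (i ∸ g zero))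

blockOf<⇔ : ∀ {m} (g : Fin m → ℕ) i {k} → k ≤ m → blockOf g i < k ⇔ i < prefixSum g k
blockOf<⇔ g i z≤n = mk⇔ (λ ()) (λ ())
blockOf<⇔ {suc m} g i {suc k} (s≤s k≤m) with i <? g zero
... | yes i<g₀ = mk⇔ (λ _ → ≤-trans i<g₀ (m≤m+n (g zero) _)) (λ _ → s≤s z≤n)
... | no i≮g₀ = mk⇔ (λ { (s≤s b<k) → shiftBack (to ih b<k) }) (s≤s ∘ from ih ∘ shiftOut)
  where
  ih = blockOf<⇔ (g ∘ suc) (i ∸ g zero) k≤m
  i≡ : g zero + (i ∸ g zero) ≡ i
  i≡ = m+[n∸m]≡n (≮⇒≥ i≮g₀)
  shiftBack : i ∸ g zero < prefixSum (g ∘ suc) k → i < g zero + prefixSum (g ∘ suc) k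
  shiftBack lt = subst (_< _) i≡ (+-monoʳ-< (g zero) lt)
  shiftOut : i < g zero + prefixSum (g ∘ suc) k → i ∸ g zero < prefixSum (g ∘ suc) k
  shiftOut lt = +-cancelˡ-< (g zero) _ _ (subst (_< _) (sym i≡) lt)

blockOf-mono : ∀ {m} (g : Fin m → ℕ) {i i′} → i ≤ i′ → blockOf g i ≤ blockOf g i′
blockOf-mono {zero} g _ = z≤n
blockOf-mono {suc m} g {i} {i′} i≤i′ with i <? g zero | i′ <? g zero
... | yes _ | _ = z≤n
... | no i≮g₀ | yes i′<g₀ = ⊥-elim (i≮g₀ (≤-<-trans i≤i′ i′<g₀))
... | no _ | no _ = s≤s (blockOf-mono (g ∘ suc) (∸-monoˡ-≤ (g zero) i≤i′))

code : Step → ℕ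
code U = 2
code H = 1
code D = 0

code≤2 : ∀ s → code s ≤ 2
code≤2 U = s≤s (s≤s z≤n)
code≤2 H = s≤s z≤n
code≤2 D = z≤n

stepOf-code : ∀ s → stepOf (code s) ≡ s
stepOf-code U = refl
stepOf-code H = refl
stepOf-code D = refl

code-stepOf : ∀ {c} → c ≤ 2 → code (stepOf c) ≡ c
code-stepOf z≤n = refl
code-stepOf (s≤s z≤n) = refl
code-stepOf (s≤s (s≤s z≤n)) = refl

-- The path with steps of multiplicities g, started at height h, is at height
-- h + prefixSum g k − k after k steps.
MotzkinFrom : ∀ {m} → ℕ → (Fin m → ℕ) → Set
MotzkinFrom {m} h g = (∀ k → k ≤ m → k ≤ h + prefixSum g k) × (h + prefixSum g m ≡ m)

motzkinFrom-cong : ∀ {m h} {f g : Fin m → ℕ} → (∀ j → f j ≡ g j) → MotzkinFrom h f → MotzkinFrom h g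
motzkinFrom-cong {m} {h} f≗g (above , total) =
  (λ k k≤m → subst (λ x → k ≤ h + x) (prefixSum-cong f≗g k) (above k k≤m)) ,
  subst (λ x → h + x ≡ m) (prefixSum-cong f≗g m) total

motzkinFrom-uncons : ∀ {m h h′} (g : Fin (suc m) → ℕ) → h + g zero ≡ suc h′ →
                     MotzkinFrom h g ⇔ MotzkinFrom h′ (g ∘ suc)
motzkinFrom-uncons {m} {h} {h′} g eq = mk⇔
  (λ (above , total) → (λ k k≤m → s≤s⁻¹ (subst (suc k ≤_) (peel k) (above (suc k) (s≤s k≤m)))) ,
                       suc-injective (trans (sym (peel m)) total))
  (λ (above , total) → (λ { zero _ → z≤n ; (suc k) (s≤s k≤m) → subst (suc k ≤_) (sym (peel k)) (s≤s (above k k≤m)) }) ,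
                       trans (peel m) (cong suc total))
  where
  peel : ∀ k → h + prefixSum g (suc k) ≡ suc (h′ + prefixSum (g ∘ suc) k)
  peel k = trans (sym (+-assoc h (g zero) _)) (cong (_+ prefixSum (g ∘ suc) k) eq)

¬motzkinFrom-stuck : ∀ {m h} (g : Fin (suc m) → ℕ) → h + g zero ≡ 0 → ¬ MotzkinFrom h g
¬motzkinFrom-stuck {h = h} g eq (above , _) = 1+n≰n (subst (1 ≤_) stuck (above 1 (s≤s z≤n)))
  where
  stuck : h + (g zero + 0) ≡ 0
  stuck = trans (cong (_+_ h) (+-identityʳ (g zero))) eq

height-step : ∀ s h {h′} → h + code s ≡ suc h′ → + h +ℤ Δ s ≡ + h′
height-step U h eq = cong +_ (suc-injective (trans (sym (+-suc h 1)) eq))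
height-step H h eq = cong +_ (trans (+-identityʳ h) (suc-injective (trans (sym (+-comm h 1)) eq)))
height-step D (suc h) eq = cong +_ (suc-injective (trans (sym (+-identityʳ (suc h))) eq))

height-stuck : ∀ s h → h + code s ≡ 0 → + h +ℤ Δ s ≡ -[1+ 0 ]
height-stuck D zero refl = refl

nonNegFrom⇔motzkinFrom : ∀ {m} (v : Vec Step m) h → NonNegFrom (+ h) (toList v) ⇔ MotzkinFrom h (code ∘ Vec.lookup v)
nonNegFrom⇔motzkinFrom [] h = mk⇔
  (λ { refl → (λ { zero _ → z≤n }) , refl })
  (λ (_ , h+0≡0) → cong +_ (trans (sym (+-identityʳ h)) h+0≡0))
nonNegFrom⇔motzkinFrom (s ∷ v) h with h + code s in eq
... | zero = mk⇔ (λ (0≤h′ , _) → ⊥-elim (negative (subst (0ℤ ≤ℤ_) (height-stuck s h eq) 0≤h′)))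
                 (⊥-elim ∘ ¬motzkinFrom-stuck (code ∘ Vec.lookup (s ∷ v)) eq)
  where
  negative : ¬ (0ℤ ≤ℤ -[1+ 0 ])
  negative ()
... | suc h′ rewrite height-step s h eq = mk⇔
  (from (motzkinFrom-uncons _ eq) ∘ to (nonNegFrom⇔motzkinFrom v h′) ∘ proj₂)
  (λ motz → +≤+ z≤n , from (nonNegFrom⇔motzkinFrom v h′) (to (motzkinFrom-uncons _ eq) motz))

module _ {a} {A : Set a} (_≟_ : DecidableEquality A) where

  multiplicity : A → List A → ℕ
  multiplicity x xs = length (filter (_≟ x) xs)

  multiplicity-here : ∀ x xs → multiplicity x (x ∷ xs) ≡ suc (multiplicity x xs)
  multiplicity-here x xs with x ≟ x
  ... | yes _ = refl
  ... | no x≢x = ⊥-elim (x≢x refl)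

  multiplicity-∷-cancel : ∀ x {y xs zs} → multiplicity y (x ∷ xs) ≡ multiplicity y (x ∷ zs) →
                          multiplicity y xs ≡ multiplicity y zs
  multiplicity-∷-cancel x {y} eq with x ≟ y
  ... | yes _ = suc-injective eq
  ... | no _ = eq

  multiplicity-suc⇒∈ : ∀ {x ys k} → multiplicity x ys ≡ suc k → x ∈ ys
  multiplicity-suc⇒∈ {x} {y ∷ ys} eq with y ≟ x
  ... | yes refl = here refl
  ... | no _ = there (multiplicity-suc⇒∈ eq)

  ↭-multiplicity : ∀ {xs ys} → xs ↭ ys → ∀ x → multiplicity x xs ≡ multiplicity x ys
  ↭-multiplicity xs↭ys x = ↭-length (filter-↭ (_≟ x) xs↭ys)

  multiplicity⇒↭ : ∀ xs ys → (∀ x → multiplicity x xs ≡ multiplicity x ys) → xs ↭ ys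
  multiplicity⇒↭ [] [] _ = _↭_.refl
  multiplicity⇒↭ [] (y ∷ ys) same with () ← trans (same y) (multiplicity-here y ys)
  multiplicity⇒↭ (x ∷ xs) ys same
    with as , bs , refl ← ∈-∃++ (multiplicity-suc⇒∈ {x} {ys} (trans (sym (same x)) (multiplicity-here x xs))) =
    ↭-trans (prep x (multiplicity⇒↭ xs (as ++ bs) same′)) (↭-sym (shift x as bs))
    where
    same′ : ∀ y → multiplicity y xs ≡ multiplicity y (as ++ bs)
    same′ y = multiplicity-∷-cancel x (trans (same y) (↭-multiplicity (shift x as bs) y))

count-∑ : ∀ {n} (p : Word n) j → count p j ≡ ∑[ i < n ] indicator (p i ≟ j)
count-∑ p j = length-filter-tabulate (λ i → p i ≟ j) (λ i → i)

count≡multiplicity : ∀ {n} (p : Word n) j → count p j ≡ multiplicity _≟_ j (List.tabulate p)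
count≡multiplicity p j = trans (count-∑ p j) (sym (length-filter-tabulate (_≟ j) p))

count-∼ : ∀ {n} {p p′ : Word n} → p ∼ p′ → ∀ j → count p′ j ≡ count p j
count-∼ {n} {p} {p′} (σ , p′≗pσ) j = begin
  count p′ j                                     ≡⟨ count-∑ p′ j ⟩
  ∑[ i < n ] indicator (p′ i ≟ j)                ≡⟨ sum-cong-≗ (λ i → cong (λ x → indicator (x ≟ j)) (p′≗pσ i)) ⟩
  ∑[ i < n ] indicator (p (σ ⟨$⟩ʳ i) ≟ j)        ≡⟨ sum-permute (λ i → indicator (p i ≟ j)) σ ⟨
  ∑[ i < n ] indicator (p i ≟ j)                 ≡⟨ count-∑ p j ⟨
  count p j                                      ∎
  where open ≡-Reasoning

tabulate-↭⇒∼ : ∀ {n} (p p′ : Word n) → List.tabulate p′ ↭ List.tabulate p → p ∼ p′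
tabulate-↭⇒∼ {n} p p′ p′↭p = σ , p′≗pσ
  where
  p′↭ₛp = ↭⇒↭ₛ p′↭p
  len′ = sym (List.length-tabulate p′)
  len = List.length-tabulate p
  σ : Permutation′ n
  σ = cast-id len′ ∘ₚ (↭ₛ.onIndices p′↭ₛp ∘ₚ cast-id len)
  p′≗pσ : ∀ i → p′ i ≡ permute σ p i
  p′≗pσ i = begin
    p′ i                                     ≡⟨ List.lookup-tabulate p′ i ⟨
    lookup (List.tabulate p′) (cast len′ i)  ≡⟨ ↭ₛProperties.onIndices-lookup (setoid (Fin n)) p′↭ₛp (cast len′ i) ⟩
    lookup (List.tabulate p) j               ≡⟨ cong (lookup (List.tabulate p)) (cast-involutive (sym len) len j) ⟨
    lookup (List.tabulate p) (cast (sym len) (cast len j)) ≡⟨ List.lookup-tabulate p (cast len j) ⟩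
    p (cast len j)                           ∎
    where
    open ≡-Reasoning
    j = ↭ₛ.onIndices p′↭ₛp ⟨$⟩ʳ cast len′ i

sameCount⇒∼ : ∀ {n} (p p′ : Word n) → (∀ j → count p j ≡ count p′ j) → p ∼ p′
sameCount⇒∼ p p′ same = tabulate-↭⇒∼ p p′ (multiplicity⇒↭ _≟_ (List.tabulate p′) (List.tabulate p)
  (λ j → trans (sym (count≡multiplicity p′ j)) (trans (sym (same j)) (count≡multiplicity p j))))

countBelow : ∀ {n} → Word n → ℕ → ℕ
countBelow {n} p k = ∑[ i < n ] indicator (toℕ (p i) <? k)

prefixSum-count : ∀ {n} (p : Word n) k → prefixSum (count p) k ≡ countBelow p k
prefixSum-count {n} p k = begin
  prefixSum (count p) k                                  ≡⟨ prefixSum-cong (count-∑ p) k ⟩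
  prefixSum (λ j → ∑[ i < n ] indicator (p i ≟ j)) k     ≡⟨ prefixSum-distrib-∑ (λ i j → indicator (p i ≟ j)) k ⟩
  ∑[ i < n ] prefixSum (λ j → indicator (p i ≟ j)) k     ≡⟨ sum-cong-≗ (λ i → prefixSum-indicator (p i) k) ⟩
  countBelow p k                                         ∎
  where open ≡-Reasoning

countBelow-total : ∀ {n} (p : Word n) → countBelow p n ≡ n
countBelow-total {n} p = trans
  (sum-cong-≗ (λ i → indicator-cong (toℕ (p i) <? n) (toℕ i <? n) (λ _ → toℕ<n i) (λ _ → toℕ<n (p i))))
  (∑-indicator-< n ≤-refl)

parking⇒countBelow≥ : ∀ {n} {p : Word n} → IsParkingFunction p → ∀ k → k ≤ n → k ≤ countBelow p k
parking⇒countBelow≥ {n} {p} (σ , _ , sorted≤i) k k≤n = begin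
  k                                                ≡⟨ ∑-indicator-< k k≤n ⟨
  ∑[ i < n ] indicator (toℕ i <? k)                ≤⟨ sum-mono-≤ (λ i → indicator-mono (toℕ i <? k) (toℕ (permute σ p i) <? k)
                                                                          (≤-<-trans (sorted≤i i))) ⟩
  ∑[ i < n ] indicator (toℕ (permute σ p i) <? k)  ≡⟨ sum-permute (λ i → indicator (toℕ (p i) <? k)) σ ⟨
  countBelow p k                                   ∎
  where open ≤-Reasoning

parking⇒motzkinFrom : ∀ {n} {p : Word n} → IsParkingFunction p → MotzkinFrom 0 (count p)
parking⇒motzkinFrom {n} {p} pf =
  (λ k k≤n → subst (k ≤_) (sym (prefixSum-count p k)) (parking⇒countBelow≥ pf k k≤n)) ,
  trans (prefixSum-count p n) (countBelow-total p)

motzkinFrom⇒parking : ∀ {n} (g : Fin n → ℕ) → MotzkinFrom 0 g →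
                      Σ (Word n) λ p → IsParkingFunction p × (∀ j → count p j ≡ g j)
motzkinFrom⇒parking {n} g (above , total) = p , (Perm.id , sorted , p≤i) , count-p
  where
  block<n : ∀ i → blockOf g (toℕ i) < n
  block<n i = from (blockOf<⇔ g (toℕ i) ≤-refl) (subst (toℕ i <_) (sym total) (toℕ<n i))
  p : Word n
  p i = fromℕ< (block<n i)
  toℕ-p : ∀ i → toℕ (p i) ≡ blockOf g (toℕ i)
  toℕ-p i = toℕ-fromℕ< (block<n i)
  sorted : NonDecreasing p
  sorted i j i≤j = subst₂ _≤_ (sym (toℕ-p i)) (sym (toℕ-p j)) (blockOf-mono g i≤j)
  p≤i : ∀ i → toℕ (p i) ≤ toℕ i
  p≤i i = s≤s⁻¹ (subst (_< suc (toℕ i)) (sym (toℕ-p i))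
    (from (blockOf<⇔ g (toℕ i) (toℕ<n i)) (above (suc (toℕ i)) (toℕ<n i))))
  prefixSums-agree : ∀ k → k ≤ n → prefixSum (count p) k ≡ prefixSum g k
  prefixSums-agree k k≤n = begin
    prefixSum (count p) k                              ≡⟨ prefixSum-count p k ⟩
    ∑[ i < n ] indicator (toℕ (p i) <? k)              ≡⟨ sum-cong-≗ (λ i → indicator-cong (toℕ (p i) <? k) (toℕ i <? prefixSum g k)
                                                            (to (blockOf<⇔ g (toℕ i) k≤n) ∘ subst (_< k) (toℕ-p i))
                                                            (subst (_< k) (sym (toℕ-p i)) ∘ from (blockOf<⇔ g (toℕ i) k≤n))) ⟩
    ∑[ i < n ] indicator (toℕ i <? prefixSum g k)      ≡⟨ ∑-indicator-< (prefixSum g k) (subst (prefixSum g k ≤_) total (prefixSum-mono g k≤n)) ⟩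
    prefixSum g k                                      ∎
    where open ≡-Reasoning
  count-p : ∀ j → count p j ≡ g j
  count-p = prefixSum-injective prefixSums-agree

code-lookup-Φ : ∀ {n} {p : Word n} → IsMotzPF p → ∀ j → code (Vec.lookup (Φ p) j) ≡ count p j
code-lookup-Φ {p = p} (_ , count≤2) j =
  trans (cong code (Vec.lookup∘tabulate (stepOf ∘ count p) j)) (code-stepOf (count≤2 j))

Φ-resp-∼ : ∀ {n} {p p′ : Word n} → p ∼ p′ → Φ p ≡ Φ p′
Φ-resp-∼ p∼p′ = Vec.tabulate-cong (λ j → cong stepOf (sym (count-∼ p∼p′ j)))

Φ-motzkin : ∀ {n} {p : Word n} → IsMotzPF p → IsMotzkin (Φ p)
Φ-motzkin {p = p} motzPF@(pf , _) =
  from (nonNegFrom⇔motzkinFrom (Φ p) 0) (motzkinFrom-cong (sym ∘ code-lookup-Φ motzPF) (parking⇒motzkinFrom pf))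

Φ-injective : ∀ {n} {p p′ : Word n} → IsMotzPF p → IsMotzPF p′ → Φ p ≡ Φ p′ → p ∼ p′
Φ-injective {p = p} {p′} motzPF motzPF′ Φp≡Φp′ = sameCount⇒∼ p p′ λ j → begin
  count p j                     ≡⟨ code-lookup-Φ motzPF j ⟨
  code (Vec.lookup (Φ p) j)     ≡⟨ cong (λ v → code (Vec.lookup v j)) Φp≡Φp′ ⟩
  code (Vec.lookup (Φ p′) j)    ≡⟨ code-lookup-Φ motzPF′ j ⟩
  count p′ j                    ∎
  where open ≡-Reasoning

Φ-surjective : ∀ {n} (w : Vec Step n) → IsMotzkin w → Σ (Word n) λ p → IsMotzPF p × (Φ p ≡ w)
Φ-surjective w motzkin
  with p , pf , count-p ← motzkinFrom⇒parking (code ∘ Vec.lookup w) (to (nonNegFrom⇔motzkinFrom w 0) motzkin) =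
  p , (pf , λ j → subst (_≤ 2) (sym (count-p j)) (code≤2 (Vec.lookup w j))) , Φp≡w
  where
  Φp≡w : Φ p ≡ w
  Φp≡w = trans (Vec.tabulate-cong (λ j → trans (cong stepOf (count-p j)) (stepOf-code (Vec.lookup w j))))
               (Vec.tabulate∘lookup w)

theorem3p4 : (n : ℕ) →
    ((p p' : Word n) → IsMotzPF p → IsMotzPF p' → p ∼ p' → Φ p ≡ Φ p')
    × ((p : Word n) → IsMotzPF p → IsMotzkin (Φ p))
    × ((p p' : Word n) → IsMotzPF p → IsMotzPF p' → Φ p ≡ Φ p' → p ∼ p')
    × ((w : Vec Step n) → IsMotzkin w → Σ (Word n) λ p → IsMotzPF p × (Φ p ≡ w))
theorem3p4 n =
  (λ _ _ _ _ → Φ-resp-∼) ,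
  (λ _ → Φ-motzkin) ,
  (λ _ _ → Φ-injective) ,
  Φ-surjective
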